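{- Let $\alpha>1$ and let $r$ be a maximal repetition of a word $w$ with $e(r)\ge3$. Let $\sigma$ be the principal repeat of $r$. Then the minimal period of the copies of $\sigma$ is greater than $p(\sigma)/(3\alpha)$, where $p(\sigma)=p(r)$. In other words, $\sigma$ is $\alpha$-nonperiodic.
   Context: $w$ has length $n$. For a factor $w[i..j]$ we write $\mathrm{beg}=i$ and $\mathrm{end}=j$. A period of a word $x$ is any $p$ with $x[i]=x[i+p]$ for all valid $i$; $p(x)$ is the minimal period and $e(x)=|x|/p(x)$. A maximal repetition is a factor $r$ with $e(r)\ge2$ satisfying two conditions: if $\mathrm{beg}(r)>1$ then $w[\mathrm{beg}(r)-1]\ne w[\mathrm{beg}(r)+p(r)-1]$, and if $\mathrm{end}(r)<n$ then $w[\mathrm{end}(r)-p(r)+1]\ne w[\mathrm{end}(r)+1]$. The principal repeat of $r$ is the pair of equal factors $u'=w[\mathrm{beg}(r)..\mathrm{end}(r)-p(r)]$ and $u''=w[\mathrm{beg}(r)+p(r)..\mathrm{end}(r)]$. Its period is $\mathrm{beg}(u'')-\mathrm{beg}(u')=p(r)$. A repeat with copies $u',u''$ and period $p(\sigma)$ is $\alpha$-periodic if the minimal period of the word $u'$ is at most $p(\sigma)/(3\alpha)$; otherwise it is $\alpha$-nonperiodic.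
   Formalization: The parameter α ranges over the rationals greater than 1. -}

module Defs where

open import Data.Nat using (ℕ; zero; suc; _+_; _*_; _∸_; _≤_; _<_)
open import Data.List using (List; []; _∷_; length; take; drop)
open import Data.Maybe using (Maybe; just; nothing)
open import Data.Product using (_×_)
open import Data.Integer using (+_)
open import Data.Rational using (ℚ; _/_) renaming (_*_ to _*ℚ_; _<_ to _<ℚ_)
open import Relation.Binary.PropositionalEquality using (_≡_; _≢_)

at : {A : Set} → List A → ℕ → Maybe A
at []       _       = nothing
at (x ∷ _)  zero    = just x
at (_ ∷ xs) (suc i) = at xs i

-- The factor w[i..j] (0-based, inclusive bounds).
fac : {A : Set} → List A → ℕ → ℕ → List A
fac w i j = take (suc j ∸ i) (drop i w)

IsPeriod : {A : Set} → List A → ℕ → Set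
IsPeriod x p = (0 < p) × (∀ i → i + p < length x → at x i ≡ at x (i + p))

MinimalPeriod : {A : Set} → List A → ℕ → Set
MinimalPeriod x p = IsPeriod x p × (∀ q → IsPeriod x q → p ≤ q)

-- r = w[b..e] (0-based) is a maximal repetition of w with minimal period p.
-- e(r) ≥ 2 is written |r| ≥ 2 p(r).
MaximalRepetition : {A : Set} → List A → ℕ → ℕ → ℕ → Set
MaximalRepetition w b e p =
  (b ≤ e) × (e < length w) ×
  MinimalPeriod (fac w b e) p ×
  (2 * p ≤ length (fac w b e)) ×
  (0 < b → at w (b ∸ 1) ≢ at w (b + p ∸ 1)) ×
  (suc e < length w → at w (suc e ∸ p) ≢ at w (suc e))

-- Copies of the principal repeat of r = w[b..e] with period p:
-- u' = w[b..e-p], u'' = w[b+p..e]; its period is p.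
principalFirst : {A : Set} → List A → ℕ → ℕ → ℕ → List A
principalFirst w b e p = fac w b (e ∸ p)

principalSecond : {A : Set} → List A → ℕ → ℕ → ℕ → List A
principalSecond w b e p = fac w (b + p) e

-- A repeat with first copy u' and period pσ is α-periodic iff p(u') ≤ pσ/(3α);
-- α-nonperiodic: the minimal period of u' is > pσ/(3α), i.e. pσ < 3·α·p(u').
AlphaNonperiodic : {A : Set} → ℚ → List A → ℕ → Set
AlphaNonperiodic α u′ pσ = ∀ q → MinimalPeriod u′ q → (+ pσ / 1) <ℚ ((+ 3 / 1) *ℚ α) *ℚ (+ q / 1)

-- A prefix of the repetition r that is at least p + q long and has period q
-- forces period q on all of r: read any position of r modulo p inside the
-- prefix, shift by q there, and shift back by the same multiple of p. The
-- first copy u' of the principal repeat is the prefix of r of length |r| - p,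
-- which is at least 2p when e(r) ≥ 3; so a period q < p(r) of u' would be a
-- period of r, contradicting minimality. Hence p(u') ≥ p(r) > p(r)/(3α).
module Submission where

open import Defs
open import Data.Nat as ℕ using (ℕ; zero; suc; _+_; _*_; _∸_; _⊓_; _≤_; z≤n; s≤s; NonZero)
open import Data.Nat.Properties
open import Data.Nat.DivMod using (_%_; _/_; m≡m%n+[m/n]*n; m%n<n)
open import Data.Nat.Coprimality using (1-coprimeTo) renaming (sym to coprime-sym)
open import Data.List using (List; _∷_; length; take; drop)
open import Data.List.Properties using (length-take; take-take)
open import Data.Product using (_,_; proj₁; proj₂)
import Data.Integer as ℤ
import Data.Integer.Properties as ℤ
open import Data.Rational as ℚ using (ℚ; 1ℚ; _<_)
import Data.Rational.Properties as ℚ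
open import Relation.Binary.PropositionalEquality
open import Relation.Nullary.Decidable using (yes; no; toWitness)

private
  variable
    A : Set

at-take : ∀ m (xs : List A) i → i ℕ.< length (take m xs) → at (take m xs) i ≡ at xs i
at-take (suc m) (x ∷ xs) zero    _         = refl
at-take (suc m) (x ∷ xs) (suc i) (s≤s lt) = at-take m xs i lt

IsPeriod⇒at-+-multiple : ∀ (x : List A) {p} → IsPeriod x p →
                         ∀ k j → j + k * p ℕ.< length x → at x j ≡ at x (j + k * p)
IsPeriod⇒at-+-multiple x _ zero j _ = cong (at x) (sym (+-identityʳ j))
IsPeriod⇒at-+-multiple x {p} per (suc k) j lt = begin
  at x j               ≡⟨ IsPeriod⇒at-+-multiple x per k j (≤-<-trans (+-monoʳ-≤ j (m≤n+m (k * p) p)) lt) ⟩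
  at x (j + k * p)     ≡⟨ proj₂ per (j + k * p) (subst (ℕ._< length x) (sym shift) lt) ⟩
  at x (j + k * p + p) ≡⟨ cong (at x) shift ⟩
  at x (j + suc k * p) ∎
  where
  open ≡-Reasoning
  shift : j + k * p + p ≡ j + suc k * p
  shift = trans (+-assoc j (k * p) p) (cong (j +_) (+-comm (k * p) p))

prefix-period⇒period : ∀ (r : List A) {p q} m → IsPeriod r p → IsPeriod (take m r) q →
                       p + q ≤ length (take m r) → IsPeriod r q
prefix-period⇒period r {p} {q} m per-p per-q long = proj₁ per-q , shift-q
  where
  instance
    p≢0 : NonZero p
    p≢0 = ℕ.>-nonZero (proj₁ per-p)
  shift-q : ∀ i → i + q ℕ.< length r → at r i ≡ at r (i + q)
  shift-q i lt = begin
    at r i                 ≡⟨ cong (at r) i≡ ⟩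
    at r (j + k * p)       ≡⟨ IsPeriod⇒at-+-multiple r per-p k j (subst (ℕ._< length r) i≡ (≤-<-trans (m≤m+n i q) lt)) ⟨
    at r j                 ≡⟨ at-take m r j j<u ⟨
    at (take m r) j        ≡⟨ proj₂ per-q j jq<u ⟩
    at (take m r) (j + q)  ≡⟨ at-take m r (j + q) jq<u ⟩
    at r (j + q)           ≡⟨ IsPeriod⇒at-+-multiple r per-p k (j + q) (subst (ℕ._< length r) iq≡ lt) ⟩
    at r (j + q + k * p)   ≡⟨ cong (at r) iq≡ ⟨
    at r (i + q)           ∎
    where
    open ≡-Reasoning
    j k : ℕ
    j = i % p
    k = i / p
    i≡ : i ≡ j + k * p
    i≡ = m≡m%n+[m/n]*n i p
    iq≡ : i + q ≡ j + q + k * p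
    iq≡ = trans (cong (_+ q) i≡) (trans (+-assoc j (k * p) q)
            (trans (cong (j +_) (+-comm (k * p) q)) (sym (+-assoc j q (k * p)))))
    jq<u : j + q ℕ.< length (take m r)
    jq<u = <-≤-trans (+-monoˡ-< q (m%n<n i p)) long
    j<u : j ℕ.< length (take m r)
    j<u = ≤-<-trans (m≤m+n j q) jq<u

prefix-period-≥ : ∀ (r : List A) {p q} m → MinimalPeriod r p → 2 * p ≤ length (take m r) →
                  IsPeriod (take m r) q → p ≤ q
prefix-period-≥ r {p} {q} m (per-p , minimal) long per-q with p ≤? q
... | yes p≤q = p≤q
... | no p≰q  = minimal q (prefix-period⇒period r m per-p per-q p+q≤u)
  where
  p+q≤u : p + q ≤ length (take m r)
  p+q≤u = ≤-trans (+-monoʳ-≤ p (<⇒≤ (≰⇒> p≰q))) (subst (_≤ length (take m r)) (cong (p +_) (+-identityʳ p)) long)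

principalFirst≡take : ∀ (w : List A) b e p →
                      principalFirst w b e p ≡ take (suc (e ∸ p) ∸ b) (fac w b e)
principalFirst≡take w b e p = sym (trans (take-take (suc (e ∸ p) ∸ b) (suc e ∸ b) (drop b w))
  (cong (λ k → take k (drop b w)) (m≤n⇒m⊓n≡m (∸-monoˡ-≤ b (s≤s (m∸n≤m e p))))))

suc[m]∸n≤suc[m∸n] : ∀ m n → suc m ∸ n ≤ suc (m ∸ n)
suc[m]∸n≤suc[m∸n] m       zero    = ≤-refl
suc[m]∸n≤suc[m∸n] zero    (suc n) = ≤-trans (m∸n≤m 0 n) z≤n
suc[m]∸n≤suc[m∸n] (suc m) (suc n) = suc[m]∸n≤suc[m∸n] m n

length-principalFirst : ∀ (w : List A) b e p {k} → p + k ≤ length (fac w b e) →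
                        k ≤ length (principalFirst w b e p)
length-principalFirst w b e p {k} long rewrite principalFirst≡take w b e p
  | length-take (suc (e ∸ p) ∸ b) (fac w b e) = ⊓-glb k≤m (≤-trans (m≤n+m k p) long)
  where
  open ≤-Reasoning
  k≤m : k ≤ suc (e ∸ p) ∸ b
  k≤m = begin
    k                      ≤⟨ m+n≤o⇒m≤o∸n k (subst (_≤ length (fac w b e)) (+-comm p k) long) ⟩
    length (fac w b e) ∸ p ≤⟨ ∸-monoˡ-≤ p (subst (_≤ suc e ∸ b) (sym (length-take (suc e ∸ b) (drop b w))) (m⊓n≤m _ _)) ⟩
    suc e ∸ b ∸ p          ≡⟨ ∸-+-assoc (suc e) b p ⟩
    suc e ∸ (b + p)        ≡⟨ cong (suc e ∸_) (+-comm b p) ⟩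
    suc e ∸ (p + b)        ≡⟨ ∸-+-assoc (suc e) p b ⟨
    suc e ∸ p ∸ b          ≤⟨ ∸-monoˡ-≤ b (suc[m]∸n≤suc[m∸n] e p) ⟩
    suc (e ∸ p) ∸ b        ∎

principalFirst-period-≥ : ∀ (w : List A) b e {p q} → MinimalPeriod (fac w b e) p →
                          3 * p ≤ length (fac w b e) →
                          IsPeriod (principalFirst w b e p) q → p ≤ q
principalFirst-period-≥ w b e {p} min-p long per-q =
  prefix-period-≥ (fac w b e) (suc (e ∸ p) ∸ b) min-p
    (subst (λ u → 2 * p ≤ length u) (principalFirst≡take w b e p) (length-principalFirst w b e p long))
    (subst (λ u → IsPeriod u _) (principalFirst≡take w b e p) per-q)

ℕ/1≡mkℚ : ∀ n → ℤ.+ n ℚ./ 1 ≡ ℚ.mkℚ (ℤ.+ n) 0 (coprime-sym (1-coprimeTo n))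
ℕ/1≡mkℚ n = ℚ.normalize-coprime (coprime-sym (1-coprimeTo n))

ℕ/1-mono-≤ : ∀ {m n} → m ≤ n → ℤ.+ m ℚ./ 1 ℚ.≤ ℤ.+ n ℚ./ 1
ℕ/1-mono-≤ {m} {n} m≤n rewrite ℕ/1≡mkℚ m | ℕ/1≡mkℚ n =
  ℚ.*≤* (subst₂ ℤ._≤_ (sym (ℤ.*-identityʳ (ℤ.+ m))) (sym (ℤ.*-identityʳ (ℤ.+ n))) (ℤ.+≤+ m≤n))

ℕ/1-<-scaled : ∀ {c m n} → 1ℚ < c → m ≤ n → 0 ℕ.< n → ℤ.+ m ℚ./ 1 < c ℚ.* (ℤ.+ n ℚ./ 1)
ℕ/1-<-scaled {c} {m} {suc n} 1<c m≤n _ = ℚ.≤-<-trans (ℕ/1-mono-≤ m≤n) n<cn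
  where
  n<cn : ℤ.+ suc n ℚ./ 1 < c ℚ.* (ℤ.+ suc n ℚ./ 1)
  n<cn rewrite ℕ/1≡mkℚ (suc n) =
    subst (_< c ℚ.* n′) (ℚ.*-identityˡ n′) (ℚ.*-monoˡ-<-pos n′ 1<c)
    where
    n′ : ℚ
    n′ = ℚ.mkℚ (ℤ.+ suc n) 0 (coprime-sym (1-coprimeTo (suc n)))

1<3*α : ∀ {α} → 1ℚ < α → 1ℚ < (ℤ.+ 3 ℚ./ 1) ℚ.* α
1<3*α {α} 1<α = ℚ.<-trans 1<3 (subst (_< three ℚ.* α) (ℚ.*-identityʳ three) (ℚ.*-monoʳ-<-pos three 1<α))
  where
  three : ℚ
  three = ℤ.+ 3 ℚ./ 1
  1<3 : 1ℚ < three
  1<3 = toWitness {a? = 1ℚ ℚ.<? three} _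

proposition19 : {A : Set} (w : List A) (α : ℚ) → 1ℚ < α → (b e p : ℕ) → MaximalRepetition w b e p → 3 * p ≤ length (fac w b e) → AlphaNonperiodic α (principalFirst w b e p) p
proposition19 w α 1<α b e p (_ , _ , min-p , _) long q (per-q , _) =
  ℕ/1-<-scaled (1<3*α 1<α) (principalFirst-period-≥ w b e min-p long per-q) (proj₁ per-q)
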